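{- There exists an $(n,m,k;1)$-strong external difference family (in some additive abelian group of order $n$) if and only if either $m=2$ and $n=k^2+1$, or $k=1$ and $m=n$.
   Context: For disjoint subsets $A,B$ of an additive abelian group $\mathcal{G}$, $\mathcal{D}(A,B)$ denotes the multiset $\{x-y : x\in A, y\in B\}$. An $(n,m,k;\lambda)$-strong external difference family (SEDF) in an additive abelian group $\mathcal{G}$ of order $n$ is a collection of $m$ pairwise disjoint $k$-subsets $A_1,\dots,A_m$ of $\mathcal{G}$ such that for every $i$, $1\le i\le m$, the multiset equation $\bigcup_{j\ne i}\mathcal{D}(A_i,A_j)=\lambda(\mathcal{G}\setminus\{0\})$ holds, i.e. every nonzero element of $\mathcal{G}$ occurs exactly $\lambda$ times as a difference $x-y$ with $x\in A_i$, $y\in A_j$, $j\neq i$. -}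

module Defs where

open import Data.Nat using (ℕ; zero; suc; _+_; _*_)
open import Data.Fin using (Fin; zero; suc)
open import Data.Fin.Properties using (_≟_)
open import Data.Fin.Subset using (Subset; _∈_; ∣_∣)
open import Data.Vec using (lookup)
open import Data.Bool using (true; false)
open import Data.Product using (_×_; ∃)
open import Data.Empty using (⊥)
open import Relation.Nullary using (¬_; yes; no)
open import Relation.Binary.PropositionalEquality using (_≡_)
open import Algebra.Structures using (IsAbelianGroup)

-- An additive abelian group of order n, realised (up to isomorphism) on the
-- n-element carrier Fin n, with propositional equality.
record FinAbGroup (n : ℕ) : Set where
  field
    _⊕_  : Fin n → Fin n → Fin n
    𝟘    : Fin n
    ⊝_   : Fin n → Fin n
    isAbelianGroup : IsAbelianGroup _≡_ _⊕_ 𝟘 ⊝_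

  _⊖_ : Fin n → Fin n → Fin n
  x ⊖ y = x ⊕ (⊝ y)

sumFin : (n : ℕ) → (Fin n → ℕ) → ℕ
sumFin zero    f = 0
sumFin (suc n) f = f zero + sumFin n (λ i → f (suc i))

ind : {n : ℕ} → Subset n → Fin n → ℕ
ind A x with lookup A x
... | true  = 1
... | false = 0

eqInd : {n : ℕ} → Fin n → Fin n → ℕ
eqInd x y with x ≟ y
... | yes _ = 1
... | no  _ = 0

diffMult : {n : ℕ} → FinAbGroup n → Subset n → Subset n → Fin n → ℕ
diffMult {n} G A B g =
  sumFin n (λ x → sumFin n (λ y → ind A x * (ind B y * eqInd (x ⊖ y) g)))
  where open FinAbGroup G

extDiffMult : {n m : ℕ} → FinAbGroup n → (Fin m → Subset n) → Fin m → Fin n → ℕ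
extDiffMult {n} {m} G A i g =
  sumFin m (λ j → notEq j)
  where
    notEq : Fin m → ℕ
    notEq j with j ≟ i
    ... | yes _ = 0
    ... | no  _ = diffMult G (A i) (A j) g

IsSEDF : {n m : ℕ} → FinAbGroup n → (Fin m → Subset n) → (k lam : ℕ) → Set
IsSEDF {n} {m} G A k lam =
  (∀ i → ∣ A i ∣ ≡ k)
  × (∀ i j → ¬ (i ≡ j) → ∀ x → x ∈ A i → x ∈ A j → ⊥)
  × (∀ i g → ¬ (g ≡ FinAbGroup.𝟘 G) → extDiffMult G A i g ≡ lam)

SEDFExists : (n m k lam : ℕ) → Set
SEDFExists n m k lam = ∃ λ (G : FinAbGroup n) → ∃ λ (A : Fin m → Subset n) → IsSEDF G A k lam

module Submission where

-- Fix a block A i.  Summed over all g, the external differences from A i count every pair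
-- (x, y) ∈ A i × A j with j ≠ i once, so there are (m - 1) k² of them; for λ = 1 they are
-- exactly the nonzero elements, whence n - 1 = (m - 1) k².  If moreover k ≥ 2, pick a ≠ a′
-- in A i.  For every other block A j the unique representation b - z of a - a′ with b ∈ A j
-- must have z ∈ A i, for otherwise a - b = a′ - z would represent a - b twice from A i.
-- Then z - b represents a′ - a from A i with partner block A j, so uniqueness forces all
-- blocks other than A i to coincide, i.e. m = 2.  Conversely, the singletons of ℤ/n and the
-- blocks {1, …, k} and {0, -k, …, -(k-1)k} of ℤ/(k² + 1) have pairwise distinct external
-- differences (a + qk runs once through 1, …, k²), and there are n - 1 of them.

open import Defs
open import Algebra.Bundles using (AbelianGroup)
open import Data.Bool using (true; false)
open import Data.Empty using (⊥)
open import Data.Fin using (Fin; zero; suc; toℕ; inject≤; inject₁; combine)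
open import Data.Fin.Properties
  using (suc-injective; _≟_; 0≢1+n; any?; toℕ-injective; toℕ-fromℕ<; toℕ<n; toℕ-inject≤; toℕ-inject₁;
         toℕ-combine; combine-injective; inject≤-injective; inject₁-injective)
open import Data.Fin.Subset using (Subset; _∈_; ∣_∣; ⁅_⁆)
open import Data.Fin.Subset.Properties using (x∈⁅y⁆⇒x≡y; ∣⁅x⁆∣≡1)
open import Data.Nat using (ℕ; zero; suc; _+_; _*_; _∸_; _≤_; _<_; z≤n; s≤s; z<s)
open import Data.Nat.DivMod using (_%_; _mod_; %-distribˡ-+; m%n%n≡m%n; m<n⇒m%n≡m; n%n≡0)
open import Data.Nat.Properties hiding (_≟_; suc-injective; 0≢1+n)
open import Algebra.Properties.Semiring.Sum +-*-semiring
  using (sum; sum-cong-≗; sum-replicate-zero; ∑-comm; ∑-distrib-+; *-distribˡ-sum; *-distribʳ-sum)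
open import Algebra.Properties.CommutativeSemigroup +-commutativeSemigroup using (xy∙z≈xz∙y)
open import Data.Product using (Σ; _×_; _,_; ∃; ∃₂; proj₁; proj₂; map; swap)
open import Data.Sum using (_⊎_; inj₁; inj₂)
open import Data.Vec using ([]; _∷_; lookup; tabulate; here; there)
open import Data.Vec.Properties using ([]=⇒lookup; lookup⇒[]=; lookup∘tabulate)
open import Function using (_∘_; id)
open import Function.Bundles using (_⇔_; mk⇔)
open import Level using (0ℓ)
open import Relation.Binary.PropositionalEquality hiding (setoid)
open import Relation.Nullary using (¬_; yes; no; does; contradiction)
open import Relation.Nullary.Decidable using (decidable-stable; dec-true)

sumFin≡sum : ∀ n (f : Fin n → ℕ) → sumFin n f ≡ sum f
sumFin≡sum zero    f = refl
sumFin≡sum (suc n) f = cong (f zero +_) (sumFin≡sum n (f ∘ suc))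

sum-const : ∀ n c → sum {n} (λ _ → c) ≡ n * c
sum-const zero    c = refl
sum-const (suc n) c = cong (c +_) (sum-const n c)

sum-zero : ∀ {n} (f : Fin n → ℕ) → (∀ x → f x ≡ 0) → sum f ≡ 0
sum-zero {n} f f≗0 = trans (sum-cong-≗ f≗0) (sum-replicate-zero n)

sum-point : ∀ {n} (f : Fin n → ℕ) c → (∀ x → ¬ x ≡ c → f x ≡ 0) → sum f ≡ f c
sum-point f zero    f≗0 = trans (cong (f zero +_) (sum-zero (f ∘ suc) λ x → f≗0 (suc x) λ ())) (+-identityʳ _)
sum-point f (suc c) f≗0 =
  cong₂ _+_ (f≗0 zero λ ()) (sum-point (f ∘ suc) c λ x x≢c → f≗0 (suc x) (x≢c ∘ suc-injective))

term≤sum : ∀ {n} (f : Fin n → ℕ) a → f a ≤ sum f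
term≤sum f zero    = m≤m+n _ _
term≤sum f (suc a) = ≤-trans (term≤sum (f ∘ suc) a) (m≤n+m _ _)

terms≤sum : ∀ {n} (f : Fin n → ℕ) {a b} → ¬ a ≡ b → f a + f b ≤ sum f
terms≤sum f {zero}  {zero}  a≢b = contradiction refl a≢b
terms≤sum f {zero}  {suc b} a≢b = +-monoʳ-≤ (f zero) (term≤sum (f ∘ suc) b)
terms≤sum f {suc a} {zero}  a≢b = subst (_≤ sum f) (+-comm (f zero) _) (+-monoʳ-≤ (f zero) (term≤sum (f ∘ suc) a))
terms≤sum f {suc a} {suc b} a≢b = ≤-trans (terms≤sum (f ∘ suc) (a≢b ∘ cong suc)) (m≤n+m _ _)

sum-pos : ∀ {n} (f : Fin n → ℕ) → 0 < sum f → ∃ λ a → 0 < f a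
sum-pos {suc n} f 0<Σ with f zero in eq
... | suc _ = zero , subst (0 <_) (sym eq) z<s
... | zero  = map suc id (sum-pos (f ∘ suc) 0<Σ)

sum≤1⇒pos-unique : ∀ {n} (f : Fin n → ℕ) → sum f ≤ 1 → ∀ {a b} → 0 < f a → 0 < f b → a ≡ b
sum≤1⇒pos-unique f Σ≤1 {a} {b} 0<fa 0<fb =
  decidable-stable (a ≟ b) λ a≢b →
    <-irrefl refl (≤-trans (+-mono-≤ 0<fa 0<fb) (≤-trans (terms≤sum f a≢b) Σ≤1))

pos-unique⇒sum≤1 : ∀ {n} (f : Fin n → ℕ) → (∀ a → f a ≤ 1) →
                   (∀ a b → 0 < f a → 0 < f b → a ≡ b) → sum f ≤ 1
pos-unique⇒sum≤1 {zero}  f f≤1 uniq = z≤n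
pos-unique⇒sum≤1 {suc n} f f≤1 uniq with f zero in eq
... | zero  = pos-unique⇒sum≤1 (f ∘ suc) (f≤1 ∘ suc) λ a b 0<fa 0<fb →
                suc-injective (uniq (suc a) (suc b) 0<fa 0<fb)
... | suc _ = +-mono-≤ (subst (_≤ 1) eq (f≤1 zero)) (≤-reflexive rest≡0)
  where
  rest≡0 : sum (f ∘ suc) ≡ 0
  rest≡0 = sum-zero (f ∘ suc) λ x →
    n≤0⇒n≡0 (≮⇒≥ λ 0<f → 0≢1+n (uniq zero (suc x) (subst (0 <_) (sym eq) z<s) 0<f))

sum-complement : ∀ {n} (f : Fin n → ℕ) → (∀ x → f x ≤ 1) → sum f + sum (λ x → 1 ∸ f x) ≡ n
sum-complement {n} f f≤1 = begin
  sum f + sum (λ x → 1 ∸ f x)  ≡⟨ ∑-distrib-+ f _ ⟨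
  sum (λ x → f x + (1 ∸ f x))  ≡⟨ sum-cong-≗ (λ x → m+[n∸m]≡n (f≤1 x)) ⟩
  sum {n} (λ _ → 1)            ≡⟨ sum-const n 1 ⟩
  n * 1                        ≡⟨ *-identityʳ n ⟩
  n                            ∎
  where open ≡-Reasoning

sum-punctured : ∀ {n} (f : Fin n → ℕ) c → f c ≡ 0 → (∀ x → ¬ x ≡ c → f x ≡ 1) → sum f + 1 ≡ n
sum-punctured f c fc≡0 f≗1 = begin
  sum f + 1                    ≡⟨ cong (λ fc → sum f + (1 ∸ fc)) fc≡0 ⟨
  sum f + (1 ∸ f c)            ≡⟨ cong (sum f +_) (sum-point _ c λ x x≢c → cong (1 ∸_) (f≗1 x x≢c)) ⟨
  sum f + sum (λ x → 1 ∸ f x)  ≡⟨ sum-complement f f≤1 ⟩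
  _                            ∎
  where
  open ≡-Reasoning
  f≤1 : ∀ x → f x ≤ 1
  f≤1 x with x ≟ c
  ... | yes refl = ≤-trans (≤-reflexive fc≡0) z≤n
  ... | no  x≢c  = ≤-reflexive (f≗1 x x≢c)

sum-punctured⁻¹ : ∀ {n} (f : Fin n → ℕ) c → (∀ x → f x ≤ 1) → f c ≡ 0 → sum f + 1 ≡ n →
                  ∀ x → ¬ x ≡ c → f x ≡ 1
sum-punctured⁻¹ f c f≤1 fc≡0 Σ+1≡n x x≢c = ≤-antisym (f≤1 x) (n≢0⇒n>0 fx≢0)
  where
  Σcomplement≡1 : sum (λ y → 1 ∸ f y) ≡ 1
  Σcomplement≡1 = +-cancelˡ-≡ (sum f) _ _ (trans (sum-complement f f≤1) (sym Σ+1≡n))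
  fx≢0 : ¬ f x ≡ 0
  fx≢0 fx≡0 = <-irrefl refl (subst (2 ≤_) Σcomplement≡1
    (subst (_≤ sum (λ y → 1 ∸ f y)) (cong₂ (λ u v → (1 ∸ u) + (1 ∸ v)) fx≡0 fc≡0)
      (terms≤sum (λ y → 1 ∸ f y) x≢c)))

sum³ : ∀ {l m n} → (Fin l → Fin m → Fin n → ℕ) → ℕ
sum³ f = sum λ a → sum λ b → sum λ c → f a b c

module _ {l m n} (f : Fin l → Fin m → Fin n → ℕ) where
  private
    F₂ : Fin l → Fin m → ℕ
    F₂ a b = sum (f a b)
    F₁ : Fin l → ℕ
    F₁ a = sum (F₂ a)
    pos₂ : ∀ {a b c} → 0 < f a b c → 0 < F₂ a b
    pos₂ {a} {b} {c} 0<f = ≤-trans 0<f (term≤sum (f a b) c)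
    pos₁ : ∀ {a b c} → 0 < f a b c → 0 < F₁ a
    pos₁ {a} {b} 0<f = ≤-trans (pos₂ 0<f) (term≤sum (F₂ a) b)
    pos₂-witness : ∀ {a b} → 0 < F₂ a b → ∃ λ c → 0 < f a b c
    pos₂-witness {a} {b} = sum-pos (f a b)
    pos₁-witness : ∀ {a} → 0 < F₁ a → ∃₂ λ b c → 0 < f a b c
    pos₁-witness {a} 0<F₁ = let b , 0<F₂ = sum-pos (F₂ a) 0<F₁ in b , pos₂-witness 0<F₂

  sum³-pos : 0 < sum³ f → ∃ λ a → ∃₂ λ b c → 0 < f a b c
  sum³-pos 0<Σ = let a , 0<F₁ = sum-pos F₁ 0<Σ in a , pos₁-witness 0<F₁

  sum³≤1⇒pos-unique : sum³ f ≤ 1 → ∀ {a b c a′ b′ c′} → 0 < f a b c → 0 < f a′ b′ c′ →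
                      a ≡ a′ × b ≡ b′ × c ≡ c′
  sum³≤1⇒pos-unique Σ≤1 {a} {b} 0<f 0<f′
    with refl ← sum≤1⇒pos-unique F₁ Σ≤1 (pos₁ 0<f) (pos₁ 0<f′)
    with F₁≤1 ← ≤-trans (term≤sum F₁ a) Σ≤1
    with refl ← sum≤1⇒pos-unique (F₂ a) F₁≤1 (pos₂ 0<f) (pos₂ 0<f′)
    = refl , refl , sum≤1⇒pos-unique (f a b) (≤-trans (term≤sum (F₂ a) b) F₁≤1) 0<f 0<f′

  pos-unique⇒sum³≤1 : (∀ a b c → f a b c ≤ 1) →
                      (∀ {a b c a′ b′ c′} → 0 < f a b c → 0 < f a′ b′ c′ → a ≡ a′ × b ≡ b′ × c ≡ c′) →
                      sum³ f ≤ 1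
  pos-unique⇒sum³≤1 f≤1 uniq = pos-unique⇒sum≤1 F₁ F₁≤1 λ a a′ 0<F 0<F′ →
    proj₁ (uniq (proj₂ (proj₂ (pos₁-witness 0<F))) (proj₂ (proj₂ (pos₁-witness 0<F′))))
    where
    F₂≤1 : ∀ a b → F₂ a b ≤ 1
    F₂≤1 a b = pos-unique⇒sum≤1 (f a b) (f≤1 a b) λ c c′ 0<f 0<f′ → proj₂ (proj₂ (uniq 0<f 0<f′))
    F₁≤1 : ∀ a → F₁ a ≤ 1
    F₁≤1 a = pos-unique⇒sum≤1 (F₂ a) (F₂≤1 a) λ b b′ 0<F 0<F′ →
      proj₁ (proj₂ (uniq (proj₂ (pos₂-witness 0<F)) (proj₂ (pos₂-witness 0<F′))))

IsIndicator : Set → ℕ → Set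
IsIndicator P b = (P × b ≡ 1) ⊎ (¬ P × b ≡ 0)

module _ {P : Set} {b : ℕ} where

  indicator-≤1 : IsIndicator P b → b ≤ 1
  indicator-≤1 (inj₁ (_ , refl)) = ≤-refl
  indicator-≤1 (inj₂ (_ , refl)) = z≤n

  indicator-pos⇒holds : IsIndicator P b → 0 < b → P
  indicator-pos⇒holds (inj₁ (p , _))    _   = p
  indicator-pos⇒holds (inj₂ (_ , refl)) ()

  indicator-holds⇒pos : IsIndicator P b → P → 0 < b
  indicator-holds⇒pos (inj₁ (_ , refl)) _ = z<s
  indicator-holds⇒pos (inj₂ (¬p , _))   p = contradiction p ¬p

  indicator-one : IsIndicator P b → P → b ≡ 1
  indicator-one (inj₁ (_ , b≡1)) _ = b≡1
  indicator-one (inj₂ (¬p , _))  p = contradiction p ¬p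

  indicator-zero : IsIndicator P b → ¬ P → b ≡ 0
  indicator-zero (inj₁ (p , _))   ¬p = contradiction p ¬p
  indicator-zero (inj₂ (_ , b≡0)) _  = b≡0

  indicator-¬ : IsIndicator P b → IsIndicator (¬ P) (1 ∸ b)
  indicator-¬ (inj₁ (p , refl))  = inj₂ ((λ ¬p → ¬p p) , refl)
  indicator-¬ (inj₂ (¬p , refl)) = inj₁ (¬p , refl)

indicator-× : ∀ {P Q a b} → IsIndicator P a → IsIndicator Q b → IsIndicator (P × Q) (a * b)
indicator-× (inj₁ (p , refl))  (inj₁ (q , refl))  = inj₁ ((p , q) , refl)
indicator-× (inj₁ (_ , refl))  (inj₂ (¬q , refl)) = inj₂ (¬q ∘ proj₂ , refl)
indicator-× (inj₂ (¬p , refl)) _                  = inj₂ (¬p ∘ proj₁ , refl)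

ind-indicator : ∀ {n} (A : Subset n) x → IsIndicator (x ∈ A) (ind A x)
ind-indicator A x with lookup A x in eq
... | true  = inj₁ (lookup⇒[]= x A eq , refl)
... | false = inj₂ ((λ x∈A → contradiction (trans (sym ([]=⇒lookup x∈A)) eq) λ ()) , refl)

eqInd-indicator : ∀ {n} (x y : Fin n) → IsIndicator (x ≡ y) (eqInd x y)
eqInd-indicator x y with x ≟ y
... | yes x≡y = inj₁ (x≡y , refl)
... | no  x≢y = inj₂ (x≢y , refl)

∣A∣≡sum-ind : ∀ {n} (A : Subset n) → ∣ A ∣ ≡ sum (ind A)
∣A∣≡sum-ind []          = refl
∣A∣≡sum-ind (true ∷ A)  = cong suc (∣A∣≡sum-ind A)
∣A∣≡sum-ind (false ∷ A) = ∣A∣≡sum-ind A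

sum-eqInd : ∀ {n} (c : Fin n) → sum (eqInd c) ≡ 1
sum-eqInd c = trans (sum-point (eqInd c) c λ x x≢c → indicator-zero (eqInd-indicator c x) (x≢c ∘ sym))
                    (indicator-one (eqInd-indicator c c) refl)

sum-offDiagonal : ∀ {m} (i : Fin m) c → sum (λ j → (1 ∸ eqInd j i) * c) + c ≡ m * c
sum-offDiagonal {m} i c = begin
  sum (λ j → (1 ∸ eqInd j i) * c) + c
    ≡⟨ cong (sum (λ j → (1 ∸ eqInd j i) * c) +_) Σdiagonal ⟨
  sum (λ j → (1 ∸ eqInd j i) * c) + sum (λ j → eqInd j i * c)
    ≡⟨ ∑-distrib-+ (λ j → (1 ∸ eqInd j i) * c) (λ j → eqInd j i * c) ⟨
  sum (λ j → (1 ∸ eqInd j i) * c + eqInd j i * c)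
    ≡⟨ sum-cong-≗ (λ j → trans (sym (*-distribʳ-+ c (1 ∸ eqInd j i) _)) (complement+diagonal j)) ⟩
  sum {m} (λ _ → c)
    ≡⟨ sum-const m c ⟩
  m * c ∎
  where
  open ≡-Reasoning
  complement+diagonal : ∀ j → ((1 ∸ eqInd j i) + eqInd j i) * c ≡ c
  complement+diagonal j = trans (cong (_* c) (m∸n+n≡m (indicator-≤1 (eqInd-indicator j i)))) (*-identityˡ c)
  Σdiagonal : sum (λ j → eqInd j i * c) ≡ c
  Σdiagonal = begin
    sum (λ j → eqInd j i * c) ≡⟨ sum-point _ i (λ j → cong (_* c) ∘ indicator-zero (eqInd-indicator j i)) ⟩
    eqInd i i * c             ≡⟨ cong (_* c) (indicator-one (eqInd-indicator i i) refl) ⟩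
    1 * c                     ≡⟨ *-identityˡ c ⟩
    c                         ∎

member : ∀ {n} {p : Subset n} → 1 ≤ ∣ p ∣ → ∃ (_∈ p)
member {p = true ∷ p}  _     = zero , here
member {p = false ∷ p} 1≤∣p∣ = map suc there (member 1≤∣p∣)

two-members : ∀ {n} {p : Subset n} → 2 ≤ ∣ p ∣ → ∃₂ λ x y → ¬ x ≡ y × x ∈ p × y ∈ p
two-members {p = true ∷ p} (s≤s 1≤∣p∣) =
  let y , y∈p = member 1≤∣p∣ in zero , suc y , 0≢1+n , here , there y∈p
two-members {p = false ∷ p} 2≤∣p∣ =
  let x , y , x≢y , x∈p , y∈p = two-members 2≤∣p∣
  in  suc x , suc y , x≢y ∘ suc-injective , there x∈p , there y∈p

image : ∀ {k n} → (Fin k → Fin n) → Subset n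
image h = tabulate λ x → does (any? λ a → h a ≟ x)

∈-image : ∀ {k n} (h : Fin k → Fin n) a → h a ∈ image h
∈-image h a =
  lookup⇒[]= (h a) (image h) (trans (lookup∘tabulate _ (h a)) (dec-true (any? λ a′ → h a′ ≟ h a) (a , refl)))

image-∈ : ∀ {k n} (h : Fin k → Fin n) {x} → x ∈ image h → ∃ λ a → h a ≡ x
image-∈ h {x} x∈img with any? (λ a → h a ≟ x) | trans (sym (lookup∘tabulate _ x)) ([]=⇒lookup x∈img)
... | yes ha≡x | _  = ha≡x
... | no  _    | ()

∣image∣ : ∀ {k n} (h : Fin k → Fin n) → (∀ {a b} → h a ≡ h b → a ≡ b) → ∣ image h ∣ ≡ k
∣image∣ {k} h h-injective = begin
  ∣ image h ∣                           ≡⟨ ∣A∣≡sum-ind (image h) ⟩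
  sum (ind (image h))                   ≡⟨ sum-cong-≗ ind-image ⟩
  sum (λ x → sum λ a → eqInd (h a) x)   ≡⟨ ∑-comm (λ x a → eqInd (h a) x) ⟩
  sum (λ a → sum (eqInd (h a)))         ≡⟨ sum-cong-≗ (sum-eqInd ∘ h) ⟩
  sum {k} (λ _ → 1)                     ≡⟨ sum-const k 1 ⟩
  k * 1                                 ≡⟨ *-identityʳ k ⟩
  k                                     ∎
  where
  open ≡-Reasoning
  ind-image : ∀ x → ind (image h) x ≡ sum λ a → eqInd (h a) x
  ind-image x with any? (λ a → h a ≟ x)
  ... | yes (a , refl) = begin
    ind (image h) (h a)            ≡⟨ indicator-one (ind-indicator (image h) (h a)) (∈-image h a) ⟩
    1                              ≡⟨ indicator-one (eqInd-indicator (h a) (h a)) refl ⟨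
    eqInd (h a) (h a)              ≡⟨ sum-point _ a (λ b → indicator-zero (eqInd-indicator (h b) (h a)) ∘ (_∘ h-injective)) ⟨
    sum (λ b → eqInd (h b) (h a))  ∎
  ... | no ∄a = trans (indicator-zero (ind-indicator (image h) x) (∄a ∘ image-∈ h))
                      (sym (sum-zero _ λ a → indicator-zero (eqInd-indicator (h a) x) (∄a ∘ (a ,_))))

module AbelianGroupDifferences {a ℓ} (G : AbelianGroup a ℓ) where
  open AbelianGroup G
  open import Algebra.Properties.AbelianGroup G
  open import Relation.Binary.Reasoning.Setoid setoid

  -‿telescope : ∀ x y z → (x - y) ∙ (y - z) ≈ x - z
  -‿telescope x y z = begin
    (x ∙ y ⁻¹) ∙ (y ∙ z ⁻¹)  ≈⟨ assoc x (y ⁻¹) (y ∙ z ⁻¹) ⟩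
    x ∙ (y ⁻¹ ∙ (y ∙ z ⁻¹))  ≈⟨ ∙-congˡ (\\-leftDividesʳ y (z ⁻¹)) ⟩
    x ∙ z ⁻¹                 ∎

  -‿exchange : ∀ {x y x′ y′} → x - x′ ≈ y - y′ → x - y ≈ x′ - y′
  -‿exchange {x} {y} {x′} {y′} eq = begin
    x - y                  ≈⟨ -‿telescope x x′ y ⟨
    (x - x′) ∙ (x′ - y)    ≈⟨ ∙-congʳ eq ⟩
    (y - y′) ∙ (x′ - y)    ≈⟨ comm (y - y′) (x′ - y) ⟩
    (x′ - y) ∙ (y - y′)    ≈⟨ -‿telescope x′ y y′ ⟩
    x′ - y′                ∎

  -‿⁻¹ : ∀ x y → x - y ⁻¹ ≈ x ∙ y
  -‿⁻¹ x y = ∙-congˡ (⁻¹-involutive y)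

finAbelianGroup : ∀ {n} → FinAbGroup n → AbelianGroup 0ℓ 0ℓ
finAbelianGroup G = record { isAbelianGroup = FinAbGroup.isAbelianGroup G }

module Cyclic (n : ℕ) where
  private
    N : ℕ
    N = suc n

  _⊕_ : Fin N → Fin N → Fin N
  x ⊕ y = (toℕ x + toℕ y) mod N

  ⊝_ : Fin N → Fin N
  ⊝ x = (N ∸ toℕ x) mod N

  toℕ-mod : ∀ a → toℕ (a mod N) ≡ a % N
  toℕ-mod a = toℕ-fromℕ< _

  toℕ-⊕ : ∀ x y → toℕ (x ⊕ y) ≡ (toℕ x + toℕ y) % N
  toℕ-⊕ x y = toℕ-mod (toℕ x + toℕ y)

  %-absorbˡ : ∀ a b → (a % N + b) % N ≡ (a + b) % N
  %-absorbˡ a b = begin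
    (a % N + b) % N            ≡⟨ %-distribˡ-+ (a % N) b N ⟩
    (a % N % N + b % N) % N    ≡⟨ cong (λ r → (r + b % N) % N) (m%n%n≡m%n a N) ⟩
    (a % N + b % N) % N        ≡⟨ %-distribˡ-+ a b N ⟨
    (a + b) % N                ∎
    where open ≡-Reasoning

  ⊕-assoc : ∀ x y z → (x ⊕ y) ⊕ z ≡ x ⊕ (y ⊕ z)
  ⊕-assoc x y z = toℕ-injective (begin
    toℕ ((x ⊕ y) ⊕ z)                          ≡⟨ toℕ-⊕ (x ⊕ y) z ⟩
    (toℕ (x ⊕ y) + toℕ z) % N                   ≡⟨ cong (λ r → (r + toℕ z) % N) (toℕ-⊕ x y) ⟩
    ((toℕ x + toℕ y) % N + toℕ z) % N           ≡⟨ %-absorbˡ (toℕ x + toℕ y) (toℕ z) ⟩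
    (toℕ x + toℕ y + toℕ z) % N                 ≡⟨ cong (_% N) (+-assoc (toℕ x) (toℕ y) (toℕ z)) ⟩
    (toℕ x + (toℕ y + toℕ z)) % N               ≡⟨ cong (_% N) (+-comm (toℕ x) _) ⟩
    (toℕ y + toℕ z + toℕ x) % N                 ≡⟨ %-absorbˡ (toℕ y + toℕ z) (toℕ x) ⟨
    ((toℕ y + toℕ z) % N + toℕ x) % N           ≡⟨ cong (_% N) (+-comm _ (toℕ x)) ⟩
    (toℕ x + (toℕ y + toℕ z) % N) % N           ≡⟨ cong (λ r → (toℕ x + r) % N) (toℕ-⊕ y z) ⟨
    (toℕ x + toℕ (y ⊕ z)) % N                   ≡⟨ toℕ-⊕ x (y ⊕ z) ⟨
    toℕ (x ⊕ (y ⊕ z))                           ∎)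
    where open ≡-Reasoning

  ⊕-comm : ∀ x y → x ⊕ y ≡ y ⊕ x
  ⊕-comm x y = cong (_mod N) (+-comm (toℕ x) (toℕ y))

  ⊕-identityˡ : ∀ x → zero ⊕ x ≡ x
  ⊕-identityˡ x = toℕ-injective (trans (toℕ-⊕ zero x) (m<n⇒m%n≡m (toℕ<n x)))

  ⊕-identityʳ : ∀ x → x ⊕ zero ≡ x
  ⊕-identityʳ x = trans (⊕-comm x zero) (⊕-identityˡ x)

  ⊕-inverseˡ : ∀ x → (⊝ x) ⊕ x ≡ zero
  ⊕-inverseˡ x = toℕ-injective (begin
    toℕ ((⊝ x) ⊕ x)                         ≡⟨ toℕ-⊕ (⊝ x) x ⟩
    (toℕ (⊝ x) + toℕ x) % N                 ≡⟨ cong (λ r → (r + toℕ x) % N) (toℕ-mod (N ∸ toℕ x)) ⟩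
    ((N ∸ toℕ x) % N + toℕ x) % N           ≡⟨ %-absorbˡ (N ∸ toℕ x) (toℕ x) ⟩
    (N ∸ toℕ x + toℕ x) % N                 ≡⟨ cong (_% N) (m∸n+n≡m (<⇒≤ (toℕ<n x))) ⟩
    N % N                                   ≡⟨ n%n≡0 N ⟩
    0                                       ∎)
    where open ≡-Reasoning

  ⊕-inverseʳ : ∀ x → x ⊕ (⊝ x) ≡ zero
  ⊕-inverseʳ x = trans (⊕-comm x (⊝ x)) (⊕-inverseˡ x)

  cyclic : FinAbGroup N
  cyclic = record
    { _⊕_ = _⊕_ ; 𝟘 = zero ; ⊝_ = ⊝_
    ; isAbelianGroup = record
      { isGroup = record
        { isMonoid = record
          { isSemigroup = record
            { isMagma = record { isEquivalence = isEquivalence ; ∙-cong = cong₂ _⊕_ }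
            ; assoc = ⊕-assoc }
          ; identity = ⊕-identityˡ , ⊕-identityʳ }
        ; inverse = ⊕-inverseˡ , ⊕-inverseʳ
        ; ⁻¹-cong = cong ⊝_ }
      ; comm = ⊕-comm } }

PairwiseDisjoint : ∀ {n m} → (Fin m → Subset n) → Set
PairwiseDisjoint A = ∀ i j → ¬ (i ≡ j) → ∀ x → x ∈ A i → x ∈ A j → ⊥

module _ {n m} (G : FinAbGroup n) (A : Fin m → Subset n) where
  open FinAbGroup G

  -- The summand of extDiffMult is a with-function local to Defs, so it cannot be named;
  -- unification recovers it, and with-abstraction on j ≟ i then unfolds it.
  private
    summand : ∀ i g → Σ (Fin m → ℕ) λ s → extDiffMult G A i g ≡ sumFin m s
    summand i g = _ , refl

    summand≡ : ∀ i g j → proj₁ (summand i g) j ≡ (1 ∸ eqInd j i) * diffMult G (A i) (A j) g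
    summand≡ i g j with j ≟ i
    ... | yes refl = refl
    ... | no _     = sym (*-identityˡ _)

  extDiffMult≡sum : ∀ i g → extDiffMult G A i g ≡ sum λ j → (1 ∸ eqInd j i) * diffMult G (A i) (A j) g
  extDiffMult≡sum i g = trans (sumFin≡sum m _) (sum-cong-≗ (summand≡ i g))

  diffMult≡sum² : ∀ B C g → diffMult G B C g ≡ sum λ x → sum λ y → ind B x * (ind C y * eqInd (x ⊖ y) g)
  diffMult≡sum² B C g =
    trans (sumFin≡sum n _) (sum-cong-≗ λ x → sumFin≡sum n λ y → ind B x * (ind C y * eqInd (x ⊖ y) g))

  sum-diffMult : ∀ B C → sum (diffMult G B C) ≡ ∣ B ∣ * ∣ C ∣
  sum-diffMult B C = begin
    sum (diffMult G B C)                          ≡⟨ sum-cong-≗ (diffMult≡sum² B C) ⟩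
    sum (λ g → sum λ x → sum λ y → t g x y)       ≡⟨ ∑-comm (λ g x → sum (t g x)) ⟩
    sum (λ x → sum λ g → sum λ y → t g x y)       ≡⟨ sum-cong-≗ (λ x → ∑-comm (λ g y → t g x y)) ⟩
    sum (λ x → sum λ y → sum λ g → t g x y)       ≡⟨ sum-cong-≗ (λ x → sum-cong-≗ (sum-t x)) ⟩
    sum (λ x → sum λ y → ind B x * ind C y)       ≡⟨ sum-cong-≗ (λ x → *-distribˡ-sum (ind B x) (ind C)) ⟨
    sum (λ x → ind B x * sum (ind C))             ≡⟨ *-distribʳ-sum (sum (ind C)) (ind B) ⟨
    sum (ind B) * sum (ind C)                     ≡⟨ cong₂ _*_ (∣A∣≡sum-ind B) (∣A∣≡sum-ind C) ⟨
    ∣ B ∣ * ∣ C ∣                                 ∎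
    where
    open ≡-Reasoning
    t : Fin n → Fin n → Fin n → ℕ
    t g x y = ind B x * (ind C y * eqInd (x ⊖ y) g)
    sum-t : ∀ x y → sum (λ g → t g x y) ≡ ind B x * ind C y
    sum-t x y = begin
      sum (λ g → t g x y)                         ≡⟨ *-distribˡ-sum (ind B x) (λ g → ind C y * eqInd (x ⊖ y) g) ⟨
      ind B x * sum (λ g → ind C y * eqInd (x ⊖ y) g)
                                                  ≡⟨ cong (ind B x *_) (*-distribˡ-sum (ind C y) (eqInd (x ⊖ y))) ⟨
      ind B x * (ind C y * sum (eqInd (x ⊖ y)))   ≡⟨ cong (λ s → ind B x * (ind C y * s)) (sum-eqInd (x ⊖ y)) ⟩
      ind B x * (ind C y * 1)                     ≡⟨ cong (ind B x *_) (*-identityʳ (ind C y)) ⟩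
      ind B x * ind C y                           ∎

  Rep : Fin m → Fin n → Fin m → Fin n → Fin n → Set
  Rep i g j x y = ¬ j ≡ i × x ∈ A i × y ∈ A j × x ⊖ y ≡ g

  UniqueRep : Fin m → Fin n → Set
  UniqueRep i g = ∀ {j x y j′ x′ y′} → Rep i g j x y → Rep i g j′ x′ y′ → j ≡ j′ × x ≡ x′ × y ≡ y′

  private
    repInd : Fin m → Fin n → Fin m → Fin n → Fin n → ℕ
    repInd i g j x y = (1 ∸ eqInd j i) * (ind (A i) x * (ind (A j) y * eqInd (x ⊖ y) g))

    repInd-indicator : ∀ i g j x y → IsIndicator (Rep i g j x y) (repInd i g j x y)
    repInd-indicator i g j x y =
      indicator-× (indicator-¬ (eqInd-indicator j i))
        (indicator-× (ind-indicator (A i) x) (indicator-× (ind-indicator (A j) y) (eqInd-indicator (x ⊖ y) g)))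

    extDiffMult≡sum³ : ∀ i g → extDiffMult G A i g ≡ sum³ (repInd i g)
    extDiffMult≡sum³ i g = trans (extDiffMult≡sum i g) (sum-cong-≗ λ j → begin
      (1 ∸ eqInd j i) * diffMult G (A i) (A j) g
        ≡⟨ cong ((1 ∸ eqInd j i) *_) (diffMult≡sum² (A i) (A j) g) ⟩
      (1 ∸ eqInd j i) * sum (λ x → sum (t j x))
        ≡⟨ *-distribˡ-sum (1 ∸ eqInd j i) (λ x → sum (t j x)) ⟩
      sum (λ x → (1 ∸ eqInd j i) * sum (t j x))
        ≡⟨ sum-cong-≗ (λ x → *-distribˡ-sum (1 ∸ eqInd j i) (t j x)) ⟩
      sum (λ x → sum λ y → repInd i g j x y) ∎)
      where
      open ≡-Reasoning
      t : Fin m → Fin n → Fin n → ℕ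
      t j x y = ind (A i) x * (ind (A j) y * eqInd (x ⊖ y) g)

  extDiffMult-pos⇒rep : ∀ i g → 0 < extDiffMult G A i g → ∃ λ j → ∃₂ λ x y → Rep i g j x y
  extDiffMult-pos⇒rep i g 0<ext with sum³-pos (repInd i g) (subst (0 <_) (extDiffMult≡sum³ i g) 0<ext)
  ... | j , x , y , 0<r = j , x , y , indicator-pos⇒holds (repInd-indicator i g j x y) 0<r

  extDiffMult≤1⇒rep-unique : ∀ i g → extDiffMult G A i g ≤ 1 → UniqueRep i g
  extDiffMult≤1⇒rep-unique i g ext≤1 {j} {x} {y} {j′} {x′} {y′} r r′ =
    sum³≤1⇒pos-unique (repInd i g) (subst (_≤ 1) (extDiffMult≡sum³ i g) ext≤1)
      (indicator-holds⇒pos (repInd-indicator i g j x y) r) (indicator-holds⇒pos (repInd-indicator i g j′ x′ y′) r′)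

  rep-unique⇒extDiffMult≤1 : ∀ i g → UniqueRep i g → extDiffMult G A i g ≤ 1
  rep-unique⇒extDiffMult≤1 i g uniq = subst (_≤ 1) (sym (extDiffMult≡sum³ i g))
    (pos-unique⇒sum³≤1 (repInd i g) (λ j x y → indicator-≤1 (repInd-indicator i g j x y))
      λ {j} {x} {y} {j′} {x′} {y′} 0<r 0<r′ →
        uniq (indicator-pos⇒holds (repInd-indicator i g j x y) 0<r) (indicator-pos⇒holds (repInd-indicator i g j′ x′ y′) 0<r′))

  extDiffMult-𝟘 : PairwiseDisjoint A → ∀ i → extDiffMult G A i 𝟘 ≡ 0
  extDiffMult-𝟘 disjoint i = n≤0⇒n≡0 (≮⇒≥ λ 0<ext → no-rep (extDiffMult-pos⇒rep i 𝟘 0<ext))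
    where
    open import Algebra.Properties.AbelianGroup (finAbelianGroup G) using (x∙y⁻¹≈ε⇒x≈y)
    no-rep : ¬ ∃ λ j → ∃₂ λ x y → Rep i 𝟘 j x y
    no-rep (j , x , y , j≢i , x∈Ai , y∈Aj , x-y≡𝟘) =
      disjoint i j (j≢i ∘ sym) x x∈Ai (subst (_∈ A j) (sym (x∙y⁻¹≈ε⇒x≈y x y x-y≡𝟘)) y∈Aj)

  sum-extDiffMult : ∀ {k} → (∀ i → ∣ A i ∣ ≡ k) → ∀ i → sum (extDiffMult G A i) + k * k ≡ m * (k * k)
  sum-extDiffMult {k} size i = begin
    sum (extDiffMult G A i) + k * k
      ≡⟨ cong (_+ k * k) (sum-cong-≗ (extDiffMult≡sum i)) ⟩
    sum (λ g → sum λ j → t j g) + k * k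
      ≡⟨ cong (_+ k * k) (∑-comm (λ g j → t j g)) ⟩
    sum (λ j → sum λ g → t j g) + k * k
      ≡⟨ cong (_+ k * k) (sum-cong-≗ λ j → *-distribˡ-sum (1 ∸ eqInd j i) (diffMult G (A i) (A j))) ⟨
    sum (λ j → (1 ∸ eqInd j i) * sum (diffMult G (A i) (A j))) + k * k
      ≡⟨ cong (_+ k * k) (sum-cong-≗ λ j → cong ((1 ∸ eqInd j i) *_) (sum-diffMult-k j)) ⟩
    sum (λ j → (1 ∸ eqInd j i) * (k * k)) + k * k
      ≡⟨ sum-offDiagonal i (k * k) ⟩
    m * (k * k) ∎
    where
    open ≡-Reasoning
    t : Fin m → Fin n → ℕ
    t j g = (1 ∸ eqInd j i) * diffMult G (A i) (A j) g
    sum-diffMult-k : ∀ j → sum (diffMult G (A i) (A j)) ≡ k * k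
    sum-diffMult-k j = trans (sum-diffMult (A i) (A j)) (cong₂ _*_ (size i) (size j))

module UnitSEDF {n m k} {G : FinAbGroup n} {A : Fin m → Subset n} (sedf : IsSEDF G A k 1) where
  open FinAbGroup G
  open import Algebra.Properties.AbelianGroup (finAbelianGroup G)
    using (x∙y⁻¹≈ε⇒x≈y; ⁻¹-injective; ε⁻¹≈ε; ⁻¹-anti-homo‿-)
  open AbelianGroupDifferences (finAbelianGroup G) using (-‿exchange)

  private
    size : ∀ i → ∣ A i ∣ ≡ k
    size = proj₁ sedf
    disjoint : PairwiseDisjoint A
    disjoint = proj₁ (proj₂ sedf)
    unique : ∀ i g → ¬ g ≡ 𝟘 → extDiffMult G A i g ≡ 1
    unique = proj₂ (proj₂ sedf)

  counting : Fin m → n + k * k ≡ m * (k * k) + 1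
  counting i = begin
    n + k * k                            ≡⟨ cong (_+ k * k) Σ+1≡n ⟨
    sum (extDiffMult G A i) + 1 + k * k  ≡⟨ xy∙z≈xz∙y (sum (extDiffMult G A i)) 1 (k * k) ⟩
    sum (extDiffMult G A i) + k * k + 1  ≡⟨ cong (_+ 1) (sum-extDiffMult G A size i) ⟩
    m * (k * k) + 1                      ∎
    where
    open ≡-Reasoning
    Σ+1≡n : sum (extDiffMult G A i) + 1 ≡ n
    Σ+1≡n = sum-punctured (extDiffMult G A i) 𝟘 (extDiffMult-𝟘 G A disjoint i) (unique i)

  rep-exists : ∀ i g → ¬ g ≡ 𝟘 → ∃ λ j → ∃₂ λ x y → Rep G A i g j x y
  rep-exists i g g≢𝟘 = extDiffMult-pos⇒rep G A i g (≤-reflexive (sym (unique i g g≢𝟘)))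

  rep-unique : ∀ i g → ¬ g ≡ 𝟘 → UniqueRep G A i g
  rep-unique i g g≢𝟘 = extDiffMult≤1⇒rep-unique G A i g (≤-reflexive (unique i g g≢𝟘))

  module _ {i a a′} (a≢a′ : ¬ a ≡ a′) (a∈Ai : a ∈ A i) (a′∈Ai : a′ ∈ A i) where
    private
      g≢𝟘 : ¬ a ⊖ a′ ≡ 𝟘
      g≢𝟘 = a≢a′ ∘ x∙y⁻¹≈ε⇒x≈y a a′

    internal-difference-partner : ∀ {j} → ¬ j ≡ i → ∃₂ λ b z → Rep G A j (a ⊖ a′) i b z
    internal-difference-partner {j} j≢i = partner-is-i (rep-exists j (a ⊖ a′) g≢𝟘)
      where
      partner-is-i : ∃ (λ l → ∃₂ λ b z → Rep G A j (a ⊖ a′) l b z) → ∃₂ λ b z → Rep G A j (a ⊖ a′) i b z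
      partner-is-i (l , b , z , r@(_ , b∈Aj , z∈Al , b-z≡g)) =
        b , z , subst (λ l → Rep G A j (a ⊖ a′) l b z) (decidable-stable (l ≟ i) ¬l≢i) r
        where
        a-b≢𝟘 : ¬ a ⊖ b ≡ 𝟘
        a-b≢𝟘 a-b≡𝟘 =
          disjoint i j (j≢i ∘ sym) a a∈Ai (subst (_∈ A j) (sym (x∙y⁻¹≈ε⇒x≈y a b a-b≡𝟘)) b∈Aj)
        ¬l≢i : ¬ ¬ l ≡ i
        ¬l≢i l≢i = a≢a′ (proj₁ (proj₂ (rep-unique i (a ⊖ b) a-b≢𝟘 (j≢i , a∈Ai , b∈Aj , refl)
                                           (l≢i , a′∈Ai , z∈Al , sym (-‿exchange (sym b-z≡g))))))

    other-blocks-coincide : ∀ {j j′} → ¬ j ≡ i → ¬ j′ ≡ i → j ≡ j′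
    other-blocks-coincide {j} {j′} j≢i j′≢i =
      let b  , z  , _ , b∈Aj   , z∈Ai  , b-z≡g   = internal-difference-partner j≢i
          b′ , z′ , _ , b′∈Aj′ , z′∈Ai , b′-z′≡g = internal-difference-partner j′≢i
      in proj₁ (rep-unique i (⊝ (a ⊖ a′)) -g≢𝟘 (j≢i , z∈Ai , b∈Aj , negate b-z≡g)
                                                (j′≢i , z′∈Ai , b′∈Aj′ , negate b′-z′≡g))
      where
      -g≢𝟘 : ¬ ⊝ (a ⊖ a′) ≡ 𝟘
      -g≢𝟘 -g≡𝟘 = g≢𝟘 (⁻¹-injective (trans -g≡𝟘 (sym ε⁻¹≈ε)))
      negate : ∀ {x y} → x ⊖ y ≡ a ⊖ a′ → y ⊖ x ≡ ⊝ (a ⊖ a′)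
      negate {x} {y} x-y≡g = trans (sym (⁻¹-anti-homo‿- x y)) (cong ⊝_ x-y≡g)

2*x+1≡1+x+x : ∀ x → 2 * x + 1 ≡ suc x + x
2*x+1≡1+x+x x = trans (+-comm (2 * x) 1) (cong (λ y → suc (x + y)) (+-identityʳ x))

unitSEDF-parameters : ∀ n m k → 2 ≤ m → 1 ≤ k → SEDFExists n m k 1 →
                      (m ≡ 2 × n ≡ k * k + 1) ⊎ (k ≡ 1 × m ≡ n)
unitSEDF-parameters n 0 k () _ _
unitSEDF-parameters n 1 k (s≤s ()) _ _
unitSEDF-parameters n 2 k _ _ (G , A , sedf) =
  inj₁ (refl , +-cancelʳ-≡ (k * k) n (k * k + 1)
                 (trans (counting zero) (trans (2*x+1≡1+x+x (k * k)) (cong (_+ k * k) (+-comm 1 (k * k))))))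
  where open UnitSEDF sedf
unitSEDF-parameters n (suc (suc (suc m))) 0 _ () _
unitSEDF-parameters n (suc (suc (suc m))) 1 _ _ (G , A , sedf) =
  inj₂ (refl , trans (sym (*-identityʳ _)) (+-cancelʳ-≡ 1 _ n (sym (counting zero))))
  where open UnitSEDF sedf
unitSEDF-parameters n (suc (suc (suc m))) (suc (suc k)) _ _ (G , A , sedf) =
  let a , a′ , a≢a′ , a∈A₀ , a′∈A₀ = two-members (subst (2 ≤_) (sym (proj₁ sedf zero)) (s≤s (s≤s z≤n)))
  in contradiction (other-blocks-coincide a≢a′ a∈A₀ a′∈A₀ {suc zero} {suc (suc zero)} (λ ()) (λ ())) λ ()
  where open UnitSEDF sedf

unitSEDF-from-unique-reps :
  ∀ {n m k} (G : FinAbGroup n) (A : Fin m → Subset n) → (∀ i → ∣ A i ∣ ≡ k) → PairwiseDisjoint A →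
  (∀ i g → UniqueRep G A i g) → n + k * k ≡ m * (k * k) + 1 → IsSEDF G A k 1
unitSEDF-from-unique-reps {n} {m} {k} G A size disjoint uniq count = size , disjoint , λ i g g≢𝟘 →
  sum-punctured⁻¹ (extDiffMult G A i) 𝟘 (λ g → rep-unique⇒extDiffMult≤1 G A i g (uniq i g))
    (extDiffMult-𝟘 G A disjoint i) (Σ+1≡n i) g g≢𝟘
  where
  open FinAbGroup G
  Σ+1≡n : ∀ i → sum (extDiffMult G A i) + 1 ≡ n
  Σ+1≡n i = +-cancelʳ-≡ (k * k) (sum (extDiffMult G A i) + 1) n (begin
    sum (extDiffMult G A i) + 1 + k * k  ≡⟨ xy∙z≈xz∙y (sum (extDiffMult G A i)) 1 (k * k) ⟩
    sum (extDiffMult G A i) + k * k + 1  ≡⟨ cong (_+ 1) (sum-extDiffMult G A size i) ⟩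
    m * (k * k) + 1                      ≡⟨ count ⟨
    n + k * k                            ∎)
    where open ≡-Reasoning

singletons-SEDF : ∀ n → SEDFExists (suc n) (suc n) 1 1
singletons-SEDF n = G , ⁅_⁆ , unitSEDF-from-unique-reps G ⁅_⁆ ∣⁅x⁆∣≡1 disjoint unique-reps count
  where
  G : FinAbGroup (suc n)
  G = Cyclic.cyclic n
  open FinAbGroup G
  open import Algebra.Properties.AbelianGroup (finAbelianGroup G) using (∙-cancelˡ; ⁻¹-injective)
  disjoint : PairwiseDisjoint ⁅_⁆
  disjoint i j i≢j x x∈⁅i⁆ x∈⁅j⁆ = i≢j (trans (sym (x∈⁅y⁆⇒x≡y i x∈⁅i⁆)) (x∈⁅y⁆⇒x≡y j x∈⁅j⁆))
  unique-reps : ∀ i g → UniqueRep G ⁅_⁆ i g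
  unique-reps i g {j} {x} {y} {j′} {x′} {y′} (_ , x∈⁅i⁆ , y∈⁅j⁆ , x-y≡g) (_ , x′∈⁅i⁆ , y′∈⁅j′⁆ , x′-y′≡g) =
    j≡j′ , trans x≡i (sym x′≡i) , trans y≡j (trans j≡j′ (sym y′≡j′))
    where
    x≡i : x ≡ i
    x≡i = x∈⁅y⁆⇒x≡y i x∈⁅i⁆
    y≡j : y ≡ j
    y≡j = x∈⁅y⁆⇒x≡y j y∈⁅j⁆
    x′≡i : x′ ≡ i
    x′≡i = x∈⁅y⁆⇒x≡y i x′∈⁅i⁆
    y′≡j′ : y′ ≡ j′
    y′≡j′ = x∈⁅y⁆⇒x≡y j′ y′∈⁅j′⁆
    j≡j′ : j ≡ j′
    j≡j′ = ⁻¹-injective (∙-cancelˡ i (⊝ j) (⊝ j′) (begin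
      i ⊖ j     ≡⟨ cong₂ _⊖_ x≡i y≡j ⟨
      x ⊖ y     ≡⟨ trans x-y≡g (sym x′-y′≡g) ⟩
      x′ ⊖ y′   ≡⟨ cong₂ _⊖_ x′≡i y′≡j′ ⟩
      i ⊖ j′    ∎))
      where open ≡-Reasoning
  count : suc n + 1 * 1 ≡ suc n * (1 * 1) + 1
  count = cong (_+ 1) (sym (*-identityʳ (suc n)))

module TwoBlocks (k′ : ℕ) where
  k : ℕ
  k = suc k′

  G : FinAbGroup (suc (k * k))
  G = Cyclic.cyclic (k * k)

  open FinAbGroup G
  open import Algebra.Properties.AbelianGroup (finAbelianGroup G) using (⁻¹-injective; ⁻¹-anti-homo‿-)
  open AbelianGroupDifferences (finAbelianGroup G) using (-‿⁻¹)
  open ≡-Reasoning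

  -- The blocks are {low a} = {1, …, k} and {⊝ step q} = {0, -k, …, -(k-1)k}.
  low : Fin k → Fin (suc (k * k))
  low a = suc (inject≤ a (m≤m*n k k))

  step : Fin k → Fin (suc (k * k))
  step q = inject₁ (combine q zero)

  low⊕step : ∀ a q → low a ⊕ step q ≡ suc (combine q a)
  low⊕step a q = toℕ-injective (begin
    toℕ (low a ⊕ step q)                       ≡⟨ Cyclic.toℕ-⊕ (k * k) (low a) (step q) ⟩
    (toℕ (low a) + toℕ (step q)) % suc (k * k) ≡⟨ cong (_% suc (k * k)) (cong₂ _+_ toℕ-low toℕ-step) ⟩
    suc (toℕ a + (k * toℕ q + 0)) % suc (k * k) ≡⟨ cong (λ r → suc r % suc (k * k)) swap-summands ⟩
    suc (k * toℕ q + toℕ a) % suc (k * k)      ≡⟨ cong (λ r → suc r % suc (k * k)) (toℕ-combine q a) ⟨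
    suc (toℕ (combine q a)) % suc (k * k)      ≡⟨ m<n⇒m%n≡m (s≤s (toℕ<n (combine q a))) ⟩
    suc (toℕ (combine q a))                    ∎)
    where
    toℕ-low : toℕ (low a) ≡ suc (toℕ a)
    toℕ-low = cong suc (toℕ-inject≤ a _)
    toℕ-step : toℕ (step q) ≡ k * toℕ q + 0
    toℕ-step = trans (toℕ-inject₁ (combine q zero)) (toℕ-combine q zero)
    swap-summands : toℕ a + (k * toℕ q + 0) ≡ k * toℕ q + toℕ a
    swap-summands = trans (cong (toℕ a +_) (+-identityʳ _)) (+-comm (toℕ a) _)

  low⊕step-injective : ∀ {a q a′ q′} → low a ⊕ step q ≡ low a′ ⊕ step q′ → a ≡ a′ × q ≡ q′
  low⊕step-injective {a} {q} {a′} {q′} eq =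
    swap (combine-injective q a q′ a′ (suc-injective (trans (sym (low⊕step a q)) (trans eq (low⊕step a′ q′)))))

  A : Fin 2 → Subset (suc (k * k))
  A zero       = image low
  A (suc zero) = image (⊝_ ∘ step)

  size : ∀ i → ∣ A i ∣ ≡ k
  size zero       = ∣image∣ low λ eq → inject≤-injective _ _ _ _ (suc-injective eq)
  size (suc zero) = ∣image∣ (⊝_ ∘ step) λ eq →
    proj₁ (combine-injective _ zero _ zero (inject₁-injective (⁻¹-injective eq)))

  cross-difference-injective : ∀ {x y x′ y′} → x ∈ A zero → y ∈ A (suc zero) →
                               x′ ∈ A zero → y′ ∈ A (suc zero) → x ⊖ y ≡ x′ ⊖ y′ → x ≡ x′ × y ≡ y′
  cross-difference-injective {x} {y} {x′} {y′} x∈A₀ y∈A₁ x′∈A₀ y′∈A₁ x-y≡x′-y′ =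
    let a  , la≡x    = image-∈ low x∈A₀
        q  , -sq≡y   = image-∈ (⊝_ ∘ step) y∈A₁
        a′ , la′≡x′  = image-∈ low x′∈A₀
        q′ , -sq′≡y′ = image-∈ (⊝_ ∘ step) y′∈A₁
        a≡a′ , q≡q′ = low⊕step-injective {a} {q} {a′} {q′} (begin
          low a ⊕ step q           ≡⟨ -‿⁻¹ (low a) (step q) ⟨
          low a ⊖ (⊝ step q)       ≡⟨ cong₂ _⊖_ la≡x -sq≡y ⟩
          x ⊖ y                    ≡⟨ x-y≡x′-y′ ⟩
          x′ ⊖ y′                  ≡⟨ cong₂ _⊖_ la′≡x′ -sq′≡y′ ⟨
          low a′ ⊖ (⊝ step q′)     ≡⟨ -‿⁻¹ (low a′) (step q′) ⟩
          low a′ ⊕ step q′         ∎)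
    in trans (sym la≡x) (trans (cong low a≡a′) la′≡x′) ,
       trans (sym -sq≡y) (trans (cong (⊝_ ∘ step) q≡q′) -sq′≡y′)

  low-not-step : ∀ {x} → x ∈ A zero → x ∈ A (suc zero) → ⊥
  low-not-step {x} x∈A₀ x∈A₁ =
    let a , la≡x  = image-∈ low x∈A₀
        q , -sq≡x = image-∈ (⊝_ ∘ step) x∈A₁
    in 0≢1+n (begin
      zero                   ≡⟨ ⊕-inverseˡ (step q) ⟨
      (⊝ step q) ⊕ step q    ≡⟨ cong (_⊕ step q) (trans -sq≡x (sym la≡x)) ⟩
      low a ⊕ step q         ≡⟨ low⊕step a q ⟩
      suc (combine q a)      ∎)
    where open Cyclic (k * k) using (⊕-inverseˡ)

  disjoint : PairwiseDisjoint A
  disjoint zero       zero       0≢0 = contradiction refl 0≢0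
  disjoint (suc zero) (suc zero) 1≢1 = contradiction refl 1≢1
  disjoint zero       (suc zero) _   x x∈A₀ x∈A₁ = low-not-step x∈A₀ x∈A₁
  disjoint (suc zero) zero       _   x x∈A₁ x∈A₀ = low-not-step x∈A₀ x∈A₁

  unique-reps : ∀ i g → UniqueRep G A i g
  unique-reps zero       g {zero}          (0≢0 , _) _ = contradiction refl 0≢0
  unique-reps zero       g {j′ = zero}     _ (0≢0 , _) = contradiction refl 0≢0
  unique-reps (suc zero) g {suc zero}      (1≢1 , _) _ = contradiction refl 1≢1
  unique-reps (suc zero) g {j′ = suc zero} _ (1≢1 , _) = contradiction refl 1≢1
  unique-reps zero g {suc zero} {j′ = suc zero} (_ , x∈A₀ , y∈A₁ , x-y≡g) (_ , x′∈A₀ , y′∈A₁ , x′-y′≡g) =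
    refl , cross-difference-injective x∈A₀ y∈A₁ x′∈A₀ y′∈A₁ (trans x-y≡g (sym x′-y′≡g))
  unique-reps (suc zero) g {zero} {x} {y} {zero} {x′} {y′} (_ , x∈A₁ , y∈A₀ , x-y≡g) (_ , x′∈A₁ , y′∈A₀ , x′-y′≡g) =
    refl , swap (cross-difference-injective y∈A₀ x∈A₁ y′∈A₀ x′∈A₁ (⁻¹-injective (begin
      ⊝ (y ⊖ x)     ≡⟨ ⁻¹-anti-homo‿- y x ⟩
      x ⊖ y         ≡⟨ trans x-y≡g (sym x′-y′≡g) ⟩
      x′ ⊖ y′       ≡⟨ ⁻¹-anti-homo‿- y′ x′ ⟨
      ⊝ (y′ ⊖ x′)   ∎)))

  sedf : SEDFExists (suc (k * k)) 2 k 1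
  sedf = G , A , unitSEDF-from-unique-reps G A size disjoint unique-reps (sym (2*x+1≡1+x+x (k * k)))

unitSEDF-exists : ∀ n m k → 2 ≤ m → 1 ≤ k → (m ≡ 2 × n ≡ k * k + 1) ⊎ (k ≡ 1 × m ≡ n) →
                  SEDFExists n m k 1
unitSEDF-exists _       _ 0       _  ()  _
unitSEDF-exists _       _ (suc k) _  _   (inj₁ (refl , refl)) =
  subst (λ n → SEDFExists n 2 (suc k) 1) (+-comm 1 (suc k * suc k)) (TwoBlocks.sedf k)
unitSEDF-exists 0       _ _       () _   (inj₂ (refl , refl))
unitSEDF-exists (suc n) _ _       _  _   (inj₂ (refl , refl)) = singletons-SEDF n

mainTheorem2 : (n m k : ℕ) → 2 ≤ m → 1 ≤ k →
    SEDFExists n m k 1 ⇔ ((m ≡ 2 × n ≡ k * k + 1) ⊎ (k ≡ 1 × m ≡ n))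
mainTheorem2 n m k 2≤m 1≤k = mk⇔ (unitSEDF-parameters n m k 2≤m 1≤k) (unitSEDF-exists n m k 2≤m 1≤k)
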